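{- Let $n \ge 10^9$ be an odd integer, let $k$ be an even integer with $\frac{2n}{5} < k < \frac{n}{2}$, and let $G$ be an $n$-vertex $k$-regular graph with at most $\frac{k}{4}(3k-n-1)$ triangles. Call an edge $e$ of $G$ heavy if the number $T(e)$ of triangles of $G$ containing $e$ satisfies $T(e) \ge \frac{3k-n-1}{3}$. Let $H$ be the spanning subgraph of $G$ whose edges are exactly the heavy edges of $G$, and let $G' = G \setminus E(H)$ (the graph obtained from $G$ by deleting all heavy edges). Then $G'$ is triangle-free.
   Context: $T(e)$ denotes the number of triangles in $G$ containing the edge $e$. -}

module Defs where

open import Data.Nat using (ℕ; zero; suc; _+_; _*_; _∸_; _≤ᵇ_)
open import Data.Fin using (Fin; zero; suc; toℕ)
open import Data.Bool using (Bool; true; false; _∧_; not; if_then_else_)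
open import Relation.Binary.PropositionalEquality using (_≡_)
open import Relation.Nullary.Decidable using (⌊_⌋)
open import Data.Nat using (_<?_)
open import Data.Empty using (⊥)

count : ∀ {n} → (Fin n → Bool) → ℕ
count {zero}  p = 0
count {suc n} p = (if p zero then 1 else 0) + count (λ i → p (suc i))

sumFin : ∀ {n} → (Fin n → ℕ) → ℕ
sumFin {zero}  f = 0
sumFin {suc n} f = f zero + sumFin (λ i → f (suc i))

record Graph (n : ℕ) : Set where
  field
    adj   : Fin n → Fin n → Bool
    sym   : ∀ u v → adj u v ≡ adj v u
    irrefl : ∀ v → adj v v ≡ false
open Graph public

degree : ∀ {n} → Graph n → Fin n → ℕ
degree G v = count (adj G v)

Regular : ∀ {n} → Graph n → ℕ → Set
Regular G k = ∀ v → degree G v ≡ k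

_<ᶠ_ : ∀ {n} → Fin n → Fin n → Bool
i <ᶠ j = ⌊ toℕ i <? toℕ j ⌋

triangles : ∀ {n} → Graph n → ℕ
triangles G = sumFin λ u → sumFin λ v → count λ w →
  (u <ᶠ v) ∧ (v <ᶠ w) ∧ adj G u v ∧ adj G v w ∧ adj G u w

-- T(uv): number of triangles containing the edge uv = common neighbours
T : ∀ {n} → Graph n → Fin n → Fin n → ℕ
T G u v = count λ w → adj G u w ∧ adj G v w

-- edge uv is heavy: uv ∈ E(G) and 3·T(uv) ≥ 3k − n − 1  (i.e. T ≥ (3k−n−1)/3)
heavy : ∀ {n} → Graph n → ℕ → Fin n → Fin n → Bool
heavy {n} G k u v = adj G u v ∧ (((3 * k) ∸ n ∸ 1) ≤ᵇ (3 * T G u v))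

removeHeavy : ∀ {n} → Graph n → ℕ → Fin n → Fin n → Bool
removeHeavy G k u v = adj G u v ∧ not (heavy G k u v)

TriangleFree : ∀ {n} → (Fin n → Fin n → Bool) → Set
TriangleFree {n} a = (u v w : Fin n) → a u v ≡ true → a v w ≡ true → a u w ≡ true → ⊥

{-# OPTIONS --safe #-}
-- If uvw were a triangle of light edges, each of T(uv), T(vw), T(uw) would be
-- below (3k − n − 1)/3.  But by inclusion–exclusion the three neighbourhoods of
-- size k inside n vertices satisfy 3k ≤ n + T(uv) + T(vw) + T(uw), so the three
-- codegrees sum to at least 3k − n − 1: a contradiction.
module Submission where

open import Defs
open import Data.Nat using (ℕ; zero; suc; _+_; _*_; _∸_; _≤_; _<_; _^_; _≤ᵇ_; s≤s; z≤n)
open import Data.Nat.Properties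
open import Data.Nat.Tactic.RingSolver using (solve-∀)
open import Data.Product using (∃)
open import Data.Bool using (Bool; true; false; _∧_; not; if_then_else_)
  renaming (T to IsTrue)
open import Data.Fin using (Fin; zero; suc)
open import Relation.Nullary using (¬_)
open import Relation.Binary.PropositionalEquality using (_≡_; refl; cong; cong₂; subst)

indicator : Bool → ℕ
indicator b = if b then 1 else 0

indicator-bonferroni : ∀ a b c →
  indicator a + indicator b + indicator c
    ≤ 1 + indicator (a ∧ b) + indicator (b ∧ c) + indicator (a ∧ c)
indicator-bonferroni true  true  true  = s≤s (s≤s (s≤s z≤n))
indicator-bonferroni true  true  false = s≤s (s≤s z≤n)
indicator-bonferroni true  false true  = s≤s (s≤s z≤n)
indicator-bonferroni true  false false = s≤s z≤n
indicator-bonferroni false true  true  = s≤s (s≤s z≤n)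
indicator-bonferroni false true  false = s≤s z≤n
indicator-bonferroni false false true  = s≤s z≤n
indicator-bonferroni false false false = z≤n

+-interchange₃ : ∀ a b c a′ b′ c′ →
  (a + b + c) + (a′ + b′ + c′) ≡ (a + a′) + (b + b′) + (c + c′)
+-interchange₃ = solve-∀

+-interchange₄ : ∀ a b c d a′ b′ c′ d′ →
  (a + b + c + d) + (a′ + b′ + c′ + d′) ≡ (a + a′) + (b + b′) + (c + c′) + (d + d′)
+-interchange₄ = solve-∀

3*m≡m+m+m : ∀ m → 3 * m ≡ m + m + m
3*m≡m+m+m = solve-∀

*-distribˡ-+₃ : ∀ m x y z → m * (x + y + z) ≡ m * x + m * y + m * z
*-distribˡ-+₃ = solve-∀

count-bonferroni : ∀ {n} (a b c : Fin n → Bool) →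
  count a + count b + count c
    ≤ n + count (λ x → a x ∧ b x) + count (λ x → b x ∧ c x) + count (λ x → a x ∧ c x)
count-bonferroni {zero}  a b c = z≤n
count-bonferroni {suc n} a b c = begin
  count a + count b + count c
    ≡⟨ +-interchange₃ (indicator (a zero)) (indicator (b zero)) (indicator (c zero))
                      (count a′) (count b′) (count c′) ⟨
  (indicator (a zero) + indicator (b zero) + indicator (c zero)) + (count a′ + count b′ + count c′)
    ≤⟨ +-mono-≤ (indicator-bonferroni (a zero) (b zero) (c zero)) (count-bonferroni a′ b′ c′) ⟩
  (1 + indicator (a zero ∧ b zero) + indicator (b zero ∧ c zero) + indicator (a zero ∧ c zero))
    + (n + count (λ x → a′ x ∧ b′ x) + count (λ x → b′ x ∧ c′ x) + count (λ x → a′ x ∧ c′ x))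
    ≡⟨ +-interchange₄ 1 (indicator (a zero ∧ b zero)) (indicator (b zero ∧ c zero))
                      (indicator (a zero ∧ c zero))
                      n (count (λ x → a′ x ∧ b′ x)) (count (λ x → b′ x ∧ c′ x))
                      (count (λ x → a′ x ∧ c′ x)) ⟩
  suc n + count (λ x → a x ∧ b x) + count (λ x → b x ∧ c x) + count (λ x → a x ∧ c x) ∎
  where
    open ≤-Reasoning
    a′ b′ c′ : Fin n → Bool
    a′ i = a (suc i)
    b′ i = b (suc i)
    c′ i = c (suc i)

regular-codegree-sum : ∀ {n k} (G : Graph n) → Regular G k → ∀ u v w →
  3 * k ∸ n ≤ T G u v + T G v w + T G u w
regular-codegree-sum {n} {k} G reg u v w = m≤n+o⇒m∸n≤o (3 * k) n (begin
  3 * k                                         ≡⟨ 3*m≡m+m+m k ⟩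
  k + k + k                                     ≡⟨ cong₂ _+_ (cong₂ _+_ (reg u) (reg v)) (reg w) ⟨
  degree G u + degree G v + degree G w          ≤⟨ count-bonferroni (adj G u) (adj G v) (adj G w) ⟩
  n + T G u v + T G v w + T G u w               ≡⟨ +-assoc (n + T G u v) (T G v w) (T G u w) ⟩
  n + T G u v + (T G v w + T G u w)             ≡⟨ +-assoc n (T G u v) _ ⟩
  n + (T G u v + (T G v w + T G u w))           ≡⟨ cong (n +_) (+-assoc (T G u v) _ _) ⟨
  n + (T G u v + T G v w + T G u w)             ∎)
  where open ≤-Reasoning

∧-not-∧-true⇒false : ∀ a b → (a ∧ not (a ∧ b)) ≡ true → b ≡ false
∧-not-∧-true⇒false true false _ = refl

≤ᵇ-false⇒> : ∀ m n → (m ≤ᵇ n) ≡ false → n < m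
≤ᵇ-false⇒> m n eq = ≰⇒> λ m≤n → subst IsTrue eq (≤⇒≤ᵇ m≤n)

light-edge-codegree : ∀ {n} (G : Graph n) k u v → removeHeavy G k u v ≡ true →
  3 * T G u v < 3 * k ∸ n ∸ 1
light-edge-codegree G k u v light =
  ≤ᵇ-false⇒> _ _ (∧-not-∧-true⇒false (adj G u v) _ light)

light-triangle-impossible : ∀ {d} x y z → 3 * x < d → 3 * y < d → 3 * z < d → ¬ (d ≤ x + y + z)
light-triangle-impossible {d} x y z x< y< z< d≤ = <-irrefl refl (begin-strict
  3 * (x + y + z)           ≡⟨ *-distribˡ-+₃ 3 x y z ⟩
  3 * x + 3 * y + 3 * z     <⟨ +-mono-< (+-mono-< x< y<) z< ⟩
  d + d + d                 ≡⟨ 3*m≡m+m+m d ⟨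
  3 * d                     ≤⟨ *-monoʳ-≤ 3 d≤ ⟩
  3 * (x + y + z)           ∎)
  where open ≤-Reasoning

proposition4p1 : (n k : ℕ) → 10 ^ 9 ≤ n → ∃ (λ m → n ≡ 2 * m + 1) → ∃ (λ m → k ≡ 2 * m)
    → 2 * n < 5 * k → 2 * k < n
    → (G : Graph n) → Regular G k
    → 4 * triangles G ≤ k * ((3 * k) ∸ n ∸ 1)
    → TriangleFree (removeHeavy G k)
proposition4p1 n k _ _ _ _ _ G reg _ u v w uv vw uw =
  light-triangle-impossible (T G u v) (T G v w) (T G u w)
    (light-edge-codegree G k u v uv)
    (light-edge-codegree G k v w vw)
    (light-edge-codegree G k u w uw)
    (≤-trans (m∸n≤m (3 * k ∸ n) 1) (regular-codegree-sum G reg u v w))
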